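{- Let $a,b$ be positive integers. Run Algorithm FindRegular on the input $(a,R;\,b,B)$, where $R$ is a fragment consisting of a single red bead and $B$ is a fragment consisting of a single black bead. Then the algorithm terminates and its output is a regular configuration in $\mathrm{CONF}(a,b)$.
   Context: For nonnegative integers $a,b$, $\mathrm{CONF}(a,b)$ denotes the set of necklaces, i.e. circular arrangements up to rotation, of $a$ red beads and $b$ black beads. For $\Delta\in\mathrm{CONF}(a,b)$ with $b>0$, label the black beads $B_0,\dots,B_{b-1}$ consecutively around the circle and let $x_i$ be the number of red beads between $B_i$ and $B_{i+1}$ (indices mod $b$). The sequence $\{x_0,\dots,x_{b-1}\}$ is a characteristic sequence of $\Delta$; it satisfies $x_0+\dots+x_{b-1}=a$ and is determined by $\Delta$ up to cyclic shift. Conversely, every sequence of nonnegative integers with sum $a$ determines a configuration. $\Delta$ is called regular if its characteristic sequence satisfies $\frac{a}{b}k-1 < x_i+x_{i+1}+\dots+x_{i+k-1} < \frac{a}{b}k+1$ for all $0\le i\le b-1$ and $1\le k\le 1+\lfloor b/2\rfloor$, with indices taken mod $b$. This condition is invariant under cyclic shifts. Algorithm FindRegular$(a,X;\,b,Y)$ takes positive integers $a,b$ and fragments $X,Y$, which are finite linear sequences of beads. It outputs a necklace made of $a$ copies of $X$ and $b$ copies of $Y$, as follows. If $a<b$, return FindRegular$(b,Y;\,a,X)$. Otherwise, write $a=bt+k$ with $t\ge 1$ and $0\le k<b$, and form the new fragment $Z$ consisting of $Y$ followed by $t$ copies of $X$. If $k\neq 0$, return FindRegular$(b,Z;\,k,X)$.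 If $k=0$, return the necklace formed by concatenating $b$ copies of $Z$ cyclically. -}

module Defs where

open import Data.Nat using (ℕ; zero; suc; _+_; _*_; _<_; _≤_; _<?_)
open import Data.Nat.DivMod using (_/_; _%_)
open import Data.List using (List; []; _∷_; _++_; concat; replicate; map; length; upTo)
open import Data.Nat.ListAction using (sum)
open import Data.Maybe using (Maybe; just; nothing)
open import Data.Product using (∃-syntax; _×_)
open import Relation.Binary.PropositionalEquality using (_≡_)
open import Relation.Nullary using (yes; no)

data Bead : Set where
  red black : Bead

Fragment : Set
Fragment = List Bead

-- A necklace is represented by a linear word; it is read cyclically
-- (i.e. up to rotation).

expand : List ℕ → List Bead
expand xs = concat (map (λ x → black ∷ replicate x red) xs)

IsCharSeq : List Bead → List ℕ → Set
IsCharSeq w xs = ∃[ u ] ∃[ v ] (w ≡ u ++ v × v ++ u ≡ expand xs)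

at : List ℕ → ℕ → ℕ
at [] _ = 0
at (x ∷ xs) zero = x
at (x ∷ xs) (suc n) = at xs n

cyc : List ℕ → ℕ → ℕ
cyc [] _ = 0
cyc (x ∷ xs) n = at (x ∷ xs) (n % suc (length xs))

window : List ℕ → ℕ → ℕ → ℕ
window xs i k = sum (map (λ j → cyc xs (i + j)) (upTo k))

-- Regularity of a characteristic sequence xs (b = length xs):
--   (a/b)k - 1 < S < (a/b)k + 1, multiplied through by b > 0:
--   a k < b (S + 1)  and  b S < a k + b.
IsRegularSeq : ℕ → List ℕ → Set
IsRegularSeq a xs =
  ∀ i k → i < length xs → 1 ≤ k → k ≤ 1 + length xs / 2 →
    (a * k < length xs * (window xs i k + 1)) ×
    (length xs * window xs i k < a * k + length xs)

RegularConf : ℕ → ℕ → List Bead → Set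
RegularConf a b w =
  ∃[ xs ] (IsCharSeq w xs × length xs ≡ b × sum xs ≡ a × IsRegularSeq a xs)

-- Algorithm FindRegular, with an explicit fuel parameter (so that
-- termination is part of what must be proved): `nothing` means the fuel
-- ran out (or the input was not positive).
findRegular : ℕ → ℕ → Fragment → ℕ → Fragment → Maybe (List Bead)
findRegular zero a X b Y = nothing
findRegular (suc f) a X b Y with a <? b
... | yes _ = findRegular f b Y a X
... | no _ = step b
  where
  step : ℕ → Maybe (List Bead)
  step zero = nothing
  step (suc b') with a % suc b'
  ... | zero = just (concat (replicate (suc b') (Y ++ concat (replicate (a / suc b') X))))
  ... | suc k' = findRegular f (suc b') (Y ++ concat (replicate (a / suc b') X)) (suc k') X

module Submission where

-- Every fragment built by the algorithm is a word in the two current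
-- fragments, so a run is described by abstract words in two letters x, y.
-- Weighting x by q and y by -p, the height of a word u is q·#x(u) - p·#y(u);
-- a word is (p,q)-balanced when any two of its prefix heights differ by less
-- than p + q.  A round of the algorithm with a = t·b + k replaces the pair of
-- fragments (X, Y) by (Y Xᵗ, X); backwards this is the substitution
-- x ↦ y xᵗ, y ↦ x, which turns (b,k)-balanced words into (a,b)-balanced ones
-- (morph-balanced), while the exchange step a < b is a letter swap
-- (swap-balanced).  By induction on the fuel, the output is therefore the
-- realisation of an (a,b)-balanced word with a letters x and b letters y
-- (findRegular-terminates).  Finally, a balanced word of total height 0 stays
-- balanced under rotation, and comparing the prefix heights of a rotation
-- that starts with a black bead gives exactly the window inequalities of
-- regularity (charWord-regular, balanced-regular).

open import Data.Bool using (Bool; true; false; not)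
open import Data.Bool.Properties using (not-involutive)
open import Data.Nat using (ℕ; zero; suc; _+_; _*_; _∸_; _≤_; _<_; z≤n; s≤s; _<?_; _≤?_; NonZero)
import Data.Nat.Properties as ℕP
open import Data.Nat.DivMod using (_/_; _%_; m≡m%n+[m/n]*n; m%n<n; m<n⇒m%n≡m; [m+n]%n≡m%n; m/n<m)
import Data.Nat.Tactic.RingSolver as ℕSolver
open import Data.Integer using (ℤ; +_; +0; +≤+; +<+)
  renaming (_+_ to _+ᶻ_; _-_ to _-ᶻ_; -_ to -ᶻ_; _≤_ to _≤ᶻ_; _<_ to _<ᶻ_)
import Data.Integer.Properties as ℤP
open import Data.Integer.Tactic.RingSolver using (solve-∀)
open import Data.List using (List; []; _∷_; _++_; replicate; length; map; concat; take; drop; applyUpTo; upTo)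
import Data.List.Properties as LP
open import Data.Nat.ListAction using (sum)
open import Data.Nat.ListAction.Properties using (sum-++)
open import Data.Maybe using (just)
open import Data.Product using (∃-syntax; _×_; _,_)
open import Data.Sum using (_⊎_; inj₁; inj₂)
open import Data.Empty using (⊥-elim)
open import Relation.Nullary using (¬_; yes; no)
open import Relation.Binary.PropositionalEquality
open ≡-Reasoning
open import Defs

-- Words in two letters: `true` is the letter x, `false` the letter y.
Word : Set
Word = List Bool

#x : Word → ℕ
#x [] = 0
#x (true ∷ u) = suc (#x u)
#x (false ∷ u) = #x u

#y : Word → ℕ
#y [] = 0
#y (true ∷ u) = #y u
#y (false ∷ u) = suc (#y u)

#x-++ : ∀ u v → #x (u ++ v) ≡ #x u + #x v
#x-++ [] v = refl
#x-++ (true ∷ u) v = cong suc (#x-++ u v)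
#x-++ (false ∷ u) v = #x-++ u v

#y-++ : ∀ u v → #y (u ++ v) ≡ #y u + #y v
#y-++ [] v = refl
#y-++ (true ∷ u) v = #y-++ u v
#y-++ (false ∷ u) v = cong suc (#y-++ u v)

additive-rotation : ∀ {A : Set} (μ : List A → ℕ) → (∀ u v → μ (u ++ v) ≡ μ u + μ v) →
  ∀ u v → μ (v ++ u) ≡ μ (u ++ v)
additive-rotation μ additive u v =
  trans (additive v u) (trans (ℕP.+-comm (μ v) (μ u)) (sym (additive u v)))

x^ : ℕ → Word
x^ n = replicate n true

#x-x^ : ∀ n → #x (x^ n) ≡ n
#x-x^ zero = refl
#x-x^ (suc n) = cong suc (#x-x^ n)

#y-x^ : ∀ n → #y (x^ n) ≡ 0
#y-x^ zero = refl
#y-x^ (suc n) = #y-x^ n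

realize : Fragment → Fragment → Word → List Bead
realize X Y [] = []
realize X Y (true ∷ w) = X ++ realize X Y w
realize X Y (false ∷ w) = Y ++ realize X Y w

realize-++ : ∀ X Y u v → realize X Y (u ++ v) ≡ realize X Y u ++ realize X Y v
realize-++ X Y [] v = refl
realize-++ X Y (true ∷ u) v = trans (cong (X ++_) (realize-++ X Y u v)) (sym (LP.++-assoc X _ _))
realize-++ X Y (false ∷ u) v = trans (cong (Y ++_) (realize-++ X Y u v)) (sym (LP.++-assoc Y _ _))

realize-x^ : ∀ X Y n → realize X Y (x^ n) ≡ concat (replicate n X)
realize-x^ X Y zero = refl
realize-x^ X Y (suc n) = cong (X ++_) (realize-x^ X Y n)

IsPrefix : ∀ {A : Set} → List A → List A → Set
IsPrefix u w = ∃[ v ] u ++ v ≡ w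

prefix-∷ : ∀ {A : Set} {c : A} {s u} → IsPrefix u (c ∷ s) →
  u ≡ [] ⊎ ∃[ u' ] (u ≡ c ∷ u' × IsPrefix u' s)
prefix-∷ {u = []} _ = inj₁ refl
prefix-∷ {u = d ∷ u'} (v , refl) = inj₂ (u' , refl , v , refl)

prefix-[] : ∀ {A : Set} {u : List A} → IsPrefix u [] → u ≡ []
prefix-[] {u = []} _ = refl
prefix-[] {u = _ ∷ _} (_ , ())

prefix-++ : ∀ {A : Set} (s : List A) {r u} → IsPrefix u (s ++ r) →
  IsPrefix u s ⊎ ∃[ m ] (u ≡ s ++ m × IsPrefix m r)
prefix-++ [] pre = inj₂ (_ , refl , pre)
prefix-++ (c ∷ s) pre with prefix-∷ pre
... | inj₁ refl = inj₁ (c ∷ s , refl)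
... | inj₂ (u' , refl , pre') with prefix-++ s pre'
...   | inj₁ (v , e) = inj₁ (v , cong (c ∷_) e)
...   | inj₂ (m , refl , pre'') = inj₂ (m , refl , pre'')

prefix-x^ : ∀ n {u} → IsPrefix u (x^ n) → ∃[ j ] (j ≤ n × u ≡ x^ j)
prefix-x^ zero pre with prefix-[] pre
... | refl = 0 , z≤n , refl
prefix-x^ (suc n) pre with prefix-∷ pre
... | inj₁ refl = 0 , z≤n , refl
... | inj₂ (u' , refl , pre') with prefix-x^ n pre'
...   | j , j≤n , refl = suc j , s≤s j≤n , refl

height : ℕ → ℕ → Word → ℤ
height p q u = + (#x u * q) -ᶻ + (#y u * p)

height-++ : ∀ p q u v → height p q (u ++ v) ≡ height p q u +ᶻ height p q v
height-++ p q u v = begin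
  + (#x (u ++ v) * q) -ᶻ + (#y (u ++ v) * p)
    ≡⟨ cong₂ (λ m n → + (m * q) -ᶻ + (n * p)) (#x-++ u v) (#y-++ u v) ⟩
  + ((#x u + #x v) * q) -ᶻ + ((#y u + #y v) * p)
    ≡⟨ cong₂ (λ m n → + m -ᶻ + n) (ℕP.*-distribʳ-+ q (#x u) (#x v)) (ℕP.*-distribʳ-+ p (#y u) (#y v)) ⟩
  + (#x u * q + #x v * q) -ᶻ + (#y u * p + #y v * p)
    ≡⟨ cong₂ _-ᶻ_ (ℤP.pos-+ (#x u * q) _) (ℤP.pos-+ (#y u * p) _) ⟩
  (+ (#x u * q) +ᶻ + (#x v * q)) -ᶻ (+ (#y u * p) +ᶻ + (#y v * p))
    ≡⟨ regroup (+ (#x u * q)) (+ (#x v * q)) (+ (#y u * p)) (+ (#y v * p)) ⟩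
  height p q u +ᶻ height p q v ∎
  where
  regroup : ∀ a b c d → (a +ᶻ b) -ᶻ (c +ᶻ d) ≡ (a -ᶻ c) +ᶻ (b -ᶻ d)
  regroup = solve-∀

height-x^ : ∀ p q n → height p q (x^ n) ≡ + (n * q)
height-x^ p q n rewrite #x-x^ n | #y-x^ n = ℤP.+-identityʳ _

height-total : ∀ {a b} w → #x w ≡ a → #y w ≡ b → height a b w ≡ +0
height-total w refl refl rewrite ℕP.*-comm (#x w) (#y w) = ℤP.+-inverseʳ (+ (#y w * #x w))

Balanced : ℕ → ℕ → Word → Set
Balanced p q w = ∀ u₁ u₂ → IsPrefix u₁ w → IsPrefix u₂ w →
  height p q u₁ -ᶻ height p q u₂ <ᶻ + (p + q)

<-by-gap : ∀ {x y} d → +0 ≤ᶻ d → y -ᶻ (+ 1 +ᶻ x) ≡ d → x <ᶻ y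
<-by-gap d 0≤d gap = ℤP.suc[i]≤j⇒i<j (ℤP.0≤i-j⇒j≤i (subst (+0 ≤ᶻ_) (sym gap) 0≤d))

gap-nonneg : ∀ {x y} → x <ᶻ y → +0 ≤ᶻ y -ᶻ (+ 1 +ᶻ x)
gap-nonneg x<y = ℤP.i≤j⇒0≤j-i (ℤP.i<j⇒suc[i]≤j x<y)

nonneg-+ : ∀ {d e} → +0 ≤ᶻ d → +0 ≤ᶻ e → +0 ≤ᶻ d +ᶻ e
nonneg-+ = ℤP.+-mono-≤

balanced-counts : ∀ {p q w u₁ u₂ x₁ y₁ x₂ y₂} → Balanced p q w →
  IsPrefix u₁ w → IsPrefix u₂ w → #x u₁ ≡ x₁ → #y u₁ ≡ y₁ → #x u₂ ≡ x₂ → #y u₂ ≡ y₂ →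
  x₁ * q + y₂ * p < x₂ * q + y₁ * p + (p + q)
balanced-counts {p} {q} {u₁ = u₁} {u₂} bal pre₁ pre₂ refl refl refl refl =
  ℤP.drop‿+<+ (subst₂ _<ᶻ_ (sym (ℤP.pos-+ (#x u₁ * q) (#y u₂ * p)))
    (sym (trans (ℤP.pos-+ (#x u₂ * q + #y u₁ * p) (p + q))
                (cong (_+ᶻ + (p + q)) (ℤP.pos-+ (#x u₂ * q) (#y u₁ * p)))))
    (<-by-gap _ (gap-nonneg (bal u₁ u₂ pre₁ pre₂))
      (regroup (+ (#x u₁ * q)) (+ (#y u₁ * p)) (+ (#x u₂ * q)) (+ (#y u₂ * p)) (+ (p + q)))))
  where
  regroup : ∀ a b c d s → ((c +ᶻ b) +ᶻ s) -ᶻ (+ 1 +ᶻ (a +ᶻ d)) ≡ s -ᶻ (+ 1 +ᶻ ((a -ᶻ b) -ᶻ (c -ᶻ d)))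
  regroup = solve-∀

-- A power of x is (p,0)-balanced for p ≥ 1: all its prefix heights vanish.
x^-balanced : ∀ p n → 1 ≤ p → Balanced p 0 (x^ n)
x^-balanced p n 1≤p u₁ u₂ pre₁ pre₂ with prefix-x^ n pre₁ | prefix-x^ n pre₂
... | j₁ , _ , refl | j₂ , _ , refl
  rewrite height-x^ p 0 j₁ | height-x^ p 0 j₂ | ℕP.*-zeroʳ j₁ | ℕP.*-zeroʳ j₂ | ℕP.+-identityʳ p =
  +<+ 1≤p

image : ℕ → Bool → Word
image t true = false ∷ x^ t
image t false = true ∷ []

morph : ℕ → Word → Word
morph t [] = []
morph t (c ∷ u) = image t c ++ morph t u

-- morph realises one round of FindRegular: X, Y become Y Xᵗ, X.
realize-morph : ∀ X Y t w → realize X Y (morph t w) ≡ realize (Y ++ concat (replicate t X)) X w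
realize-morph X Y t [] = refl
realize-morph X Y t (true ∷ w) =
  trans (cong (Y ++_) (trans (realize-++ X Y (x^ t) (morph t w))
                             (cong₂ _++_ (realize-x^ X Y t) (realize-morph X Y t w))))
        (sym (LP.++-assoc Y (concat (replicate t X)) _))
realize-morph X Y t (false ∷ w) = cong (X ++_) (realize-morph X Y t w)

#x-morph : ∀ t w → #x (morph t w) ≡ t * #x w + #y w
#x-morph t [] = sym (trans (ℕP.+-identityʳ (t * 0)) (ℕP.*-zeroʳ t))
#x-morph t (true ∷ w) = begin
  #x (x^ t ++ morph t w)        ≡⟨ #x-++ (x^ t) (morph t w) ⟩
  #x (x^ t) + #x (morph t w)    ≡⟨ cong₂ _+_ (#x-x^ t) (#x-morph t w) ⟩
  t + (t * #x w + #y w)         ≡⟨ sym (ℕP.+-assoc t _ _) ⟩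
  t + t * #x w + #y w           ≡⟨ cong (_+ #y w) (sym (ℕP.*-suc t (#x w))) ⟩
  t * suc (#x w) + #y w ∎
#x-morph t (false ∷ w) = trans (cong suc (#x-morph t w)) (sym (ℕP.+-suc (t * #x w) (#y w)))

#y-morph : ∀ t w → #y (morph t w) ≡ #x w
#y-morph t [] = refl
#y-morph t (true ∷ w) = cong suc (trans (#y-++ (x^ t) (morph t w)) (cong₂ _+_ (#y-x^ t) (#y-morph t w)))
#y-morph t (false ∷ w) = #y-morph t w

height-morph : ∀ t P Q u → height (t * P + Q) P (morph t u) ≡ -ᶻ height P Q u
height-morph t P Q u = begin
  height (t * P + Q) P (morph t u)
    ≡⟨ cong₂ (λ m n → + (m * P) -ᶻ + (n * (t * P + Q))) (#x-morph t u) (#y-morph t u) ⟩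
  + ((t * X + Y) * P) -ᶻ + (X * (t * P + Q))
    ≡⟨ cong₂ (λ m n → + m -ᶻ + n) (expand₁ t X Y P) (expand₂ t X P Q) ⟩
  + (t * X * P + Y * P) -ᶻ + (t * X * P + X * Q)
    ≡⟨ cong₂ _-ᶻ_ (ℤP.pos-+ (t * X * P) _) (ℤP.pos-+ (t * X * P) _) ⟩
  (+ (t * X * P) +ᶻ + (Y * P)) -ᶻ (+ (t * X * P) +ᶻ + (X * Q))
    ≡⟨ cancel (+ (t * X * P)) (+ (Y * P)) (+ (X * Q)) ⟩
  -ᶻ height P Q u ∎
  where
  X = #x u
  Y = #y u
  expand₁ : ∀ t X Y P → (t * X + Y) * P ≡ t * X * P + Y * P
  expand₁ = ℕSolver.solve-∀
  expand₂ : ∀ t X P Q → X * (t * P + Q) ≡ t * X * P + X * Q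
  expand₂ = ℕSolver.solve-∀
  cancel : ∀ a b c → (a +ᶻ b) -ᶻ (a +ᶻ c) ≡ -ᶻ (c -ᶻ b)
  cancel = solve-∀

height-x : ∀ p q → height p q (true ∷ []) ≡ + q
height-x p q = trans (ℤP.+-identityʳ _) (cong +_ (ℕP.+-identityʳ q))

height-yx^ : ∀ p q j → height p q (false ∷ x^ j) ≡ + (j * q) -ᶻ + p
height-yx^ p q j = trans (cong₂ (λ m n → + (m * q) -ᶻ + (suc n * p)) (#x-x^ j) (#y-x^ j))
                          (cong (λ n → + (j * q) -ᶻ + n) (ℕP.+-identityʳ p))

data MorphPrefix (t : ℕ) (w : Word) : Word → Set where
  whole : ∀ {r} → IsPrefix r w → MorphPrefix t w (morph t r)
  partial : ∀ {r j} → IsPrefix (r ++ true ∷ []) w → j ≤ t → MorphPrefix t w (morph t r ++ false ∷ x^ j)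

morph-prefix-cons : ∀ {t w u} c → MorphPrefix t w u → MorphPrefix t (c ∷ w) (image t c ++ u)
morph-prefix-cons c (whole (v , e)) = whole (v , cong (c ∷_) e)
morph-prefix-cons {t} c (partial {r} {j} (v , e) j≤t) =
  subst (MorphPrefix t _) (LP.++-assoc (image t c) (morph t r) (false ∷ x^ j))
    (partial {r = c ∷ r} (v , cong (c ∷_) e) j≤t)

morph-prefix-image : ∀ {t w u} c → IsPrefix u (image t c) → MorphPrefix t (c ∷ w) u
morph-prefix-image {t} true pre with prefix-∷ pre
... | inj₁ refl = whole {r = []} (_ , refl)
... | inj₂ (_ , refl , pre') with prefix-x^ t pre'
...   | j , j≤t , refl = partial {r = []} (_ , refl) j≤t
morph-prefix-image false pre with prefix-∷ pre
... | inj₁ refl = whole {r = []} (_ , refl)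
... | inj₂ (_ , refl , pre') with prefix-[] pre'
...   | refl = whole {r = false ∷ []} (_ , refl)

morph-prefix : ∀ t w {u} → IsPrefix u (morph t w) → MorphPrefix t w u
morph-prefix t [] pre with prefix-[] pre
... | refl = whole ([] , refl)
morph-prefix t (c ∷ w) pre with prefix-++ (image t c) pre
... | inj₁ pre' = morph-prefix-image c pre'
... | inj₂ (m , refl , pre') = morph-prefix-cons c (morph-prefix t w pre')

partial-height : ∀ t P Q r j → j ≤ t →
  height P Q (r ++ true ∷ []) ≡ -ᶻ (height (t * P + Q) P (morph t r ++ false ∷ x^ j) +ᶻ + ((t ∸ j) * P))
partial-height t P Q r j j≤t = begin
  height P Q (r ++ true ∷ [])
    ≡⟨ trans (height-++ P Q r _) (cong (height P Q r +ᶻ_) (height-x P Q)) ⟩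
  H +ᶻ + Q
    ≡⟨ regroup H (+ (j * P)) (+ ((t ∸ j) * P)) (+ Q) ⟩
  -ᶻ ((-ᶻ H +ᶻ (+ (j * P) -ᶻ ((+ (j * P) +ᶻ + ((t ∸ j) * P)) +ᶻ + Q))) +ᶻ + ((t ∸ j) * P))
    ≡⟨ cong (λ z → -ᶻ ((-ᶻ H +ᶻ (+ (j * P) -ᶻ z)) +ᶻ + ((t ∸ j) * P))) weight-split ⟩
  -ᶻ ((-ᶻ H +ᶻ (+ (j * P) -ᶻ + (t * P + Q))) +ᶻ + ((t ∸ j) * P))
    ≡⟨ cong (λ z → -ᶻ (z +ᶻ + ((t ∸ j) * P))) (sym image-height) ⟩
  -ᶻ (height (t * P + Q) P (morph t r ++ false ∷ x^ j) +ᶻ + ((t ∸ j) * P)) ∎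
  where
  H = height P Q r
  regroup : ∀ h a b c → h +ᶻ c ≡ -ᶻ ((-ᶻ h +ᶻ (a -ᶻ ((a +ᶻ b) +ᶻ c))) +ᶻ b)
  regroup = solve-∀
  tP-split : j * P + (t ∸ j) * P ≡ t * P
  tP-split = trans (sym (ℕP.*-distribʳ-+ P j (t ∸ j))) (cong (_* P) (ℕP.m+[n∸m]≡n j≤t))
  weight-split : (+ (j * P) +ᶻ + ((t ∸ j) * P)) +ᶻ + Q ≡ + (t * P + Q)
  weight-split = begin
    (+ (j * P) +ᶻ + ((t ∸ j) * P)) +ᶻ + Q ≡⟨ cong (_+ᶻ + Q) (sym (ℤP.pos-+ (j * P) _)) ⟩
    + (j * P + (t ∸ j) * P) +ᶻ + Q        ≡⟨ sym (ℤP.pos-+ _ Q) ⟩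
    + (j * P + (t ∸ j) * P + Q)           ≡⟨ cong (λ n → + (n + Q)) tP-split ⟩
    + (t * P + Q) ∎
  image-height : height (t * P + Q) P (morph t r ++ false ∷ x^ j) ≡ -ᶻ H +ᶻ (+ (j * P) -ᶻ + (t * P + Q))
  image-height = trans (height-++ _ P (morph t r) _)
    (cong₂ _+ᶻ_ (height-morph t P Q r) (height-yx^ (t * P + Q) P j))

morph-prefix-height : ∀ t P Q {w u} → MorphPrefix t w u →
  ∃[ r ] ∃[ s ] (IsPrefix r w × s ≤ t * P × height P Q r ≡ -ᶻ (height (t * P + Q) P u +ᶻ + s))
morph-prefix-height t P Q (whole {r} pre) =
  r , 0 , pre , z≤n ,
  sym (trans (cong -ᶻ_ (trans (ℤP.+-identityʳ _) (height-morph t P Q r))) (ℤP.neg-involutive _))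
morph-prefix-height t P Q (partial {r} {j} pre j≤t) =
  r ++ true ∷ [] , (t ∸ j) * P , pre , ℕP.*-monoˡ-≤ P (ℕP.m∸n≤m t j) , partial-height t P Q r j j≤t

-- Arithmetic core of morph-balanced: downward shifts in [0, T] widen the spread by at most T.
shifted-gap : ∀ {x₁ x₂ g₁ g₂ : ℤ} s₁ s₂ T C → s₂ ≤ T →
  g₁ ≡ -ᶻ (x₁ +ᶻ + s₁) → g₂ ≡ -ᶻ (x₂ +ᶻ + s₂) → g₂ -ᶻ g₁ <ᶻ + C → x₁ -ᶻ x₂ <ᶻ + (C + T)
shifted-gap {x₁} {x₂} s₁ s₂ T C s₂≤T refl refl g<C =
  <-by-gap _ (nonneg-+ (gap-nonneg g<C) (nonneg-+ (ℤP.i≤j⇒0≤j-i (+≤+ s₂≤T)) (+≤+ z≤n)))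
    (trans (cong (_-ᶻ (+ 1 +ᶻ (x₁ -ᶻ x₂))) (ℤP.pos-+ C T)) (regroup x₁ x₂ (+ s₁) (+ s₂) (+ C) (+ T)))
  where
  regroup : ∀ x₁ x₂ s₁ s₂ c t →
    (c +ᶻ t) -ᶻ (+ 1 +ᶻ (x₁ -ᶻ x₂)) ≡
    (c -ᶻ (+ 1 +ᶻ (-ᶻ (x₂ +ᶻ s₂) -ᶻ -ᶻ (x₁ +ᶻ s₁)))) +ᶻ ((t -ᶻ s₂) +ᶻ s₁)
  regroup = solve-∀

morph-balanced : ∀ t {P Q w} → Balanced P Q w → Balanced (t * P + Q) P (morph t w)
morph-balanced t {P} {Q} {w} bal u₁ u₂ pre₁ pre₂
  with morph-prefix-height t P Q (morph-prefix t w pre₁) | morph-prefix-height t P Q (morph-prefix t w pre₂)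
... | r₁ , s₁ , r₁-pre , _ , e₁ | r₂ , s₂ , r₂-pre , s₂≤tP , e₂ =
  subst (λ n → height (t * P + Q) P u₁ -ᶻ height (t * P + Q) P u₂ <ᶻ + n) (weights P Q t)
    (shifted-gap {height (t * P + Q) P u₁} {height (t * P + Q) P u₂} s₁ s₂ (t * P) (P + Q) s₂≤tP e₁ e₂ (bal r₂ r₁ r₂-pre r₁-pre))
  where
  weights : ∀ P Q t → P + Q + t * P ≡ t * P + Q + P
  weights = ℕSolver.solve-∀

swap : Word → Word
swap = map not

swap-involutive : ∀ w → swap (swap w) ≡ w
swap-involutive [] = refl
swap-involutive (c ∷ w) = cong₂ _∷_ (not-involutive c) (swap-involutive w)

#x-swap : ∀ w → #x (swap w) ≡ #y w
#x-swap [] = refl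
#x-swap (true ∷ w) = #x-swap w
#x-swap (false ∷ w) = cong suc (#x-swap w)

#y-swap : ∀ w → #y (swap w) ≡ #x w
#y-swap [] = refl
#y-swap (true ∷ w) = cong suc (#y-swap w)
#y-swap (false ∷ w) = #y-swap w

realize-swap : ∀ X Y w → realize X Y (swap w) ≡ realize Y X w
realize-swap X Y [] = refl
realize-swap X Y (true ∷ w) = cong (Y ++_) (realize-swap X Y w)
realize-swap X Y (false ∷ w) = cong (X ++_) (realize-swap X Y w)

height-swap : ∀ p q u → height p q u ≡ -ᶻ height q p (swap u)
height-swap p q u =
  trans (flip (+ (#x u * q)) (+ (#y u * p)))
        (cong -ᶻ_ (sym (cong₂ (λ m n → + (m * p) -ᶻ + (n * q)) (#x-swap u) (#y-swap u))))
  where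
  flip : ∀ a b → a -ᶻ b ≡ -ᶻ (b -ᶻ a)
  flip = solve-∀

prefix-swap : ∀ {u w} → IsPrefix u (swap w) → IsPrefix (swap u) w
prefix-swap {u} {w} (v , e) =
  swap v , trans (sym (LP.map-++ not u v)) (trans (cong swap e) (swap-involutive w))

swap-balanced : ∀ {p q w} → Balanced q p w → Balanced p q (swap w)
swap-balanced {p} {q} bal u₁ u₂ pre₁ pre₂ =
  subst₂ _<ᶻ_ (sym (trans (cong₂ _-ᶻ_ (height-swap p q u₁) (height-swap p q u₂)) (flip-diff (height q p (swap u₁)) (height q p (swap u₂)))))
    (cong +_ (ℕP.+-comm q p))
    (bal (swap u₂) (swap u₁) (prefix-swap pre₂) (prefix-swap pre₁))
  where
  flip-diff : ∀ a b → -ᶻ a -ᶻ -ᶻ b ≡ b -ᶻ a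
  flip-diff = solve-∀

BalancedRealization : ℕ → ℕ → Fragment → Fragment → List Bead → Set
BalancedRealization a b X Y out =
  ∃[ w ] (out ≡ realize X Y w × #x w ≡ a × #y w ≡ b × Balanced a b w)

realization-morph : ∀ t {P Q X Y out} →
  BalancedRealization P Q (Y ++ concat (replicate t X)) X out → BalancedRealization (t * P + Q) P X Y out
realization-morph t {X = X} {Y} (w , refl , refl , refl , bal) =
  morph t w , sym (realize-morph X Y t w) , #x-morph t w , #y-morph t w , morph-balanced t bal

realization-swap : ∀ {a b X Y out} → BalancedRealization b a Y X out → BalancedRealization a b X Y out
realization-swap {X = X} {Y} (w , refl , refl , refl , bal) =
  swap w , sym (realize-swap X Y w) , #x-swap w , #y-swap w , swap-balanced bal

euclid : ∀ a P .{{_ : NonZero P}} {r} → a % P ≡ r → (a / P) * P + r ≡ a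
euclid a P refl = trans (ℕP.+-comm _ (a % P)) (sym (m≡m%n+[m/n]*n a P))

findRegular-swap : ∀ f a b X Y → a < b → findRegular (suc f) a X b Y ≡ findRegular f b Y a X
findRegular-swap f a b X Y a<b with a <? b
... | yes _ = refl
... | no a≮b = ⊥-elim (a≮b a<b)

findRegular-exact : ∀ f a b' X Y → ¬ a < suc b' → a % suc b' ≡ 0 →
  findRegular (suc f) a X (suc b') Y ≡ just (concat (replicate (suc b') (Y ++ concat (replicate (a / suc b') X))))
findRegular-exact f a b' X Y a≮b rem with a <? suc b'
... | yes a<b = ⊥-elim (a≮b a<b)
... | no _ rewrite rem = refl

findRegular-step : ∀ f a b' k' X Y → ¬ a < suc b' → a % suc b' ≡ suc k' →
  findRegular (suc f) a X (suc b') Y ≡ findRegular f (suc b') (Y ++ concat (replicate (a / suc b') X)) (suc k') X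
findRegular-step f a b' k' X Y a≮b rem with a <? suc b'
... | yes a<b = ⊥-elim (a≮b a<b)
... | no _ rewrite rem = refl

findRegular-balanced : ∀ f a b X Y → b ≤ a → 1 ≤ b → a + b ≤ f →
  ∃[ out ] (findRegular f a X b Y ≡ just out × BalancedRealization a b X Y out)
findRegular-balanced f a zero X Y _ () _
findRegular-balanced zero a (suc b') X Y _ _ a+b≤0 with ℕP.m+n≤o⇒n≤o a a+b≤0
... | ()
findRegular-balanced (suc f) a (suc b') X Y b≤a _ a+b≤f with a % suc b' in rem
... | zero =
  _ , findRegular-exact f a b' X Y (ℕP.≤⇒≯ b≤a) rem ,
  subst (λ n → BalancedRealization n P X Y (concat (replicate P Z))) (euclid a P rem)
    (realization-morph t (x^ P , sym (realize-x^ Z X P) , #x-x^ P , #y-x^ P , x^-balanced P P (s≤s z≤n)))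
  where
  P = suc b'
  t = a / P
  Z = Y ++ concat (replicate t X)
... | suc k' with findRegular-balanced f (suc b') (suc k') (Y ++ concat (replicate (a / suc b') X)) X
                    (ℕP.<⇒≤ k<b) (s≤s z≤n) fuel
  where
  k<b : suc k' < suc b'
  k<b = subst (_< suc b') rem (m%n<n a (suc b'))
  fuel : suc b' + suc k' ≤ f
  fuel = ℕP.≤-trans (ℕP.+-mono-≤ b≤a (ℕP.≤-pred k<b))
                    (ℕP.≤-pred (subst (_≤ suc f) (ℕP.+-suc a b') a+b≤f))
...   | out , run , real =
  out , trans (findRegular-step f a b' k' X Y (ℕP.≤⇒≯ b≤a) rem) run ,
  subst (λ n → BalancedRealization n (suc b') X Y out) (euclid a (suc b') rem) (realization-morph (a / suc b') real)

findRegular-terminates : ∀ a b X Y → 1 ≤ a → 1 ≤ b →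
  ∃[ out ] (findRegular (suc (a + b)) a X b Y ≡ just out × BalancedRealization a b X Y out)
findRegular-terminates a b X Y 1≤a 1≤b with b ≤? a
... | yes b≤a = findRegular-balanced (suc (a + b)) a b X Y b≤a 1≤b (ℕP.n≤1+n _)
... | no b≰a with findRegular-balanced (a + b) b a Y X (ℕP.<⇒≤ (ℕP.≰⇒> b≰a)) 1≤a (ℕP.≤-reflexive (ℕP.+-comm b a))
...   | out , run , real = out , trans (findRegular-swap (a + b) a b X Y (ℕP.≰⇒> b≰a)) run , realization-swap real

rotation-prefix : ∀ {p q} u v {z} → height p q (u ++ v) ≡ +0 → IsPrefix z (v ++ u) →
  ∃[ y ] (IsPrefix y (u ++ v) × height p q z ≡ height p q y -ᶻ height p q u)
rotation-prefix {p} {q} u v {z} total pre with prefix-++ v pre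
... | inj₁ (m , e) =
  u ++ z , (m , trans (LP.++-assoc u z m) (cong (u ++_) e)) ,
  trans (shift (height p q u) (height p q z)) (cong (_-ᶻ height p q u) (sym (height-++ p q u z)))
  where
  shift : ∀ a c → c ≡ (a +ᶻ c) -ᶻ a
  shift = solve-∀
... | inj₂ (m , refl , (m' , e)) =
  m , (m' ++ v , trans (sym (LP.++-assoc m m' v)) (cong (_++ v) e)) , (begin
    height p q (v ++ m)                                       ≡⟨ height-++ p q v m ⟩
    height p q v +ᶻ height p q m                              ≡⟨ shift (height p q u) (height p q v) (height p q m) ⟩
    ((height p q u +ᶻ height p q v) +ᶻ height p q m) -ᶻ height p q u
      ≡⟨ cong (λ s → (s +ᶻ height p q m) -ᶻ height p q u) (trans (sym (height-++ p q u v)) total) ⟩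
    (+0 +ᶻ height p q m) -ᶻ height p q u                      ≡⟨ cong (_-ᶻ height p q u) (ℤP.+-identityˡ (height p q m)) ⟩
    height p q m -ᶻ height p q u ∎)
  where
  shift : ∀ a b c → b +ᶻ c ≡ ((a +ᶻ b) +ᶻ c) -ᶻ a
  shift = solve-∀

rotate-balanced : ∀ {p q} u v → height p q (u ++ v) ≡ +0 → Balanced p q (u ++ v) → Balanced p q (v ++ u)
rotate-balanced {p} {q} u v total bal z₁ z₂ pre₁ pre₂
  with rotation-prefix u v total pre₁ | rotation-prefix u v total pre₂
... | y₁ , pre₁' , e₁ | y₂ , pre₂' , e₂ =
  subst (_<ᶻ + (p + q)) (sym (trans (cong₂ _-ᶻ_ e₁ e₂) (cancel (height p q y₁) (height p q y₂) (height p q u)))) (bal y₁ y₂ pre₁' pre₂')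
  where
  cancel : ∀ a b c → (a -ᶻ c) -ᶻ (b -ᶻ c) ≡ a -ᶻ b
  cancel = solve-∀

charWord : List ℕ → Word
charWord [] = []
charWord (n ∷ ns) = false ∷ (x^ n ++ charWord ns)

charWord-++ : ∀ ms ns → charWord (ms ++ ns) ≡ charWord ms ++ charWord ns
charWord-++ [] ns = refl
charWord-++ (m ∷ ms) ns =
  cong (false ∷_) (trans (cong (x^ m ++_) (charWord-++ ms ns)) (sym (LP.++-assoc (x^ m) (charWord ms) _)))

charWord-split : ∀ k ns → charWord ns ≡ charWord (take k ns) ++ charWord (drop k ns)
charWord-split k ns = trans (cong charWord (sym (LP.take++drop≡id k ns))) (charWord-++ (take k ns) (drop k ns))

#x-charWord : ∀ ns → #x (charWord ns) ≡ sum ns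
#x-charWord [] = refl
#x-charWord (n ∷ ns) = trans (#x-++ (x^ n) (charWord ns)) (cong₂ _+_ (#x-x^ n) (#x-charWord ns))

#y-charWord : ∀ ns → #y (charWord ns) ≡ length ns
#y-charWord [] = refl
#y-charWord (n ∷ ns) = cong suc (trans (#y-++ (x^ n) (charWord ns)) (cong₂ _+_ (#y-x^ n) (#y-charWord ns)))

realize-red-x^ : ∀ n → realize (red ∷ []) (black ∷ []) (x^ n) ≡ replicate n red
realize-red-x^ zero = refl
realize-red-x^ (suc n) = cong (red ∷_) (realize-red-x^ n)

realize-charWord : ∀ ns → realize (red ∷ []) (black ∷ []) (charWord ns) ≡ expand ns
realize-charWord [] = refl
realize-charWord (n ∷ ns) =
  cong (black ∷_) (trans (realize-++ (red ∷ []) (black ∷ []) (x^ n) (charWord ns))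
                         (cong₂ _++_ (realize-red-x^ n) (realize-charWord ns)))

leading-x : ∀ w → ∃[ m ] ∃[ ns ] (w ≡ x^ m ++ charWord ns)
leading-x [] = 0 , [] , refl
leading-x (true ∷ w) with leading-x w
... | m , ns , e = suc m , ns , cong (true ∷_) e
leading-x (false ∷ w) with leading-x w
... | m , ns , e = 0 , m ∷ ns , cong (false ∷_) e

split-at-y : ∀ w → 1 ≤ #y w → ∃[ u ] ∃[ v ] (w ≡ u ++ false ∷ v)
split-at-y (false ∷ w) _ = [] , w , refl
split-at-y (true ∷ w) 1≤#y with split-at-y w 1≤#y
... | u , v , e = true ∷ u , v , cong (true ∷_) e

rotation-to-charWord : ∀ w → 1 ≤ #y w → ∃[ u ] ∃[ v ] ∃[ ns ] (w ≡ u ++ v × v ++ u ≡ charWord ns)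
rotation-to-charWord w 1≤#y with split-at-y w 1≤#y
... | u , v , refl with leading-x (v ++ u)
...   | m , ns , e = u , false ∷ v , m ∷ ns , refl , cong (false ∷_) e

at-++ˡ : ∀ D T j → j < length D → at (D ++ T) j ≡ at D j
at-++ˡ (d ∷ D) T zero _ = refl
at-++ˡ (d ∷ D) T (suc j) (s≤s j<) = at-++ˡ D T j j<

at-++ʳ : ∀ D T m → at (D ++ T) (length D + m) ≡ at T m
at-++ʳ [] T m = refl
at-++ʳ (d ∷ D) T m = at-++ʳ D T m

at-drop : ∀ ns i j → at ns (i + j) ≡ at (drop i ns) j
at-drop [] zero j = refl
at-drop [] (suc i) j = refl
at-drop (n ∷ ns) zero j = refl
at-drop (n ∷ ns) (suc i) j = at-drop ns i j

at-take : ∀ ns i j → j < i → at (take i ns) j ≡ at ns j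
at-take [] (suc i) j _ = refl
at-take (n ∷ ns) (suc i) zero _ = refl
at-take (n ∷ ns) (suc i) (suc j) (s≤s j<i) = at-take ns i j j<i

cyc-at : ∀ ns m → m < length ns → cyc ns m ≡ at ns m
cyc-at (n ∷ ns) m m< = cong (at (n ∷ ns)) (m<n⇒m%n≡m m<)

cyc-periodic : ∀ ns m → cyc ns (m + length ns) ≡ cyc ns m
cyc-periodic [] m = refl
cyc-periodic (n ∷ ns) m = cong (at (n ∷ ns)) ([m+n]%n≡m%n m (suc (length ns)))

rotation : List ℕ → ℕ → List ℕ
rotation ns i = drop i ns ++ take i ns

length-rotation : ∀ ns i → length (rotation ns i) ≡ length ns
length-rotation ns i =
  trans (LP.length-++-comm (drop i ns) (take i ns)) (cong length (LP.take++drop≡id i ns))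

sum-rotation : ∀ ns i → sum (rotation ns i) ≡ sum ns
sum-rotation ns i =
  trans (additive-rotation sum sum-++ (take i ns) (drop i ns)) (cong sum (LP.take++drop≡id i ns))

cyc-rotation : ∀ ns i j → i < length ns → j < length ns → cyc ns (i + j) ≡ at (rotation ns i) j
cyc-rotation ns i j i<n j<n with j <? length (drop i ns)
... | yes j<d = begin
  cyc ns (i + j)          ≡⟨ cyc-at ns (i + j) i+j<n ⟩
  at ns (i + j)           ≡⟨ at-drop ns i j ⟩
  at (drop i ns) j        ≡⟨ sym (at-++ˡ (drop i ns) (take i ns) j j<d) ⟩
  at (rotation ns i) j ∎
  where
  i+j<n : i + j < length ns
  i+j<n = subst (i + j <_) (ℕP.m+[n∸m]≡n (ℕP.<⇒≤ i<n))
            (ℕP.+-monoʳ-< i (subst (j <_) (LP.length-drop i ns) j<d))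
... | no j≮d = begin
  cyc ns (i + j)                               ≡⟨ cong (cyc ns) wrap ⟩
  cyc ns (m + length ns)                       ≡⟨ cyc-periodic ns m ⟩
  cyc ns m                                     ≡⟨ cyc-at ns m (ℕP.<-trans m<i i<n) ⟩
  at ns m                                      ≡⟨ sym (at-take ns i m m<i) ⟩
  at (take i ns) m                             ≡⟨ sym (at-++ʳ (drop i ns) (take i ns) m) ⟩
  at (rotation ns i) (length (drop i ns) + m)  ≡⟨ cong (at (rotation ns i)) (sym j≡d+m) ⟩
  at (rotation ns i) j ∎
  where
  d = length (drop i ns)
  m = j ∸ d
  j≡d+m : j ≡ d + m
  j≡d+m = sym (ℕP.m+[n∸m]≡n (ℕP.≮⇒≥ j≮d))
  d+i≡n : d + i ≡ length ns
  d+i≡n = trans (cong (_+ i) (LP.length-drop i ns)) (ℕP.m∸n+n≡m (ℕP.<⇒≤ i<n))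
  wrap : i + j ≡ m + length ns
  wrap = begin
    i + j        ≡⟨ cong (λ n → i + n) j≡d+m ⟩
    i + (d + m)  ≡⟨ sym (ℕP.+-assoc i d m) ⟩
    i + d + m    ≡⟨ cong (_+ m) (trans (ℕP.+-comm i d) d+i≡n) ⟩
    length ns + m ≡⟨ ℕP.+-comm (length ns) m ⟩
    m + length ns ∎
  m<i : m < i
  m<i = ℕP.+-cancelˡ-< d m i (subst₂ _<_ j≡d+m (sym d+i≡n) j<n)

applyUpTo-cong : ∀ {f g : ℕ → ℕ} k → (∀ j → j < k → f j ≡ g j) → applyUpTo f k ≡ applyUpTo g k
applyUpTo-cong zero _ = refl
applyUpTo-cong (suc k) f≡g = cong₂ _∷_ (f≡g 0 (s≤s z≤n)) (applyUpTo-cong k (λ j j<k → f≡g (suc j) (s≤s j<k)))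

applyUpTo-at : ∀ ns k → k ≤ length ns → applyUpTo (at ns) k ≡ take k ns
applyUpTo-at ns zero _ = refl
applyUpTo-at (n ∷ ns) (suc k) (s≤s k≤) = cong (n ∷_) (applyUpTo-at ns k k≤)

window-rotation : ∀ ns i k → i < length ns → k ≤ length ns → window ns i k ≡ sum (take k (rotation ns i))
window-rotation ns i k i<n k≤n = cong sum (begin
  map (λ j → cyc ns (i + j)) (upTo k)  ≡⟨ LP.map-upTo _ k ⟩
  applyUpTo (λ j → cyc ns (i + j)) k   ≡⟨ applyUpTo-cong k (λ j j<k → cyc-rotation ns i j i<n (ℕP.<-≤-trans j<k k≤n)) ⟩
  applyUpTo (at (rotation ns i)) k      ≡⟨ applyUpTo-at (rotation ns i) k (subst (k ≤_) (sym (length-rotation ns i)) k≤n) ⟩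
  take k (rotation ns i) ∎)

-- Windows in the regularity condition never exceed the whole circle.
half-bound : ∀ n k → 1 ≤ n → k ≤ 1 + n / 2 → k ≤ n
half-bound (suc n) k _ k≤ = ℕP.≤-trans k≤ (m/n<m (suc n) 2 (s≤s (s≤s z≤n)))

y-prefix : ∀ ns → 1 ≤ length ns → IsPrefix (false ∷ []) (charWord ns)
y-prefix (n ∷ ns) _ = x^ n ++ charWord ns , refl

take-prefix : ∀ k ns → IsPrefix (charWord (take k ns)) (charWord ns)
take-prefix k ns = charWord (drop k ns) , sym (charWord-split k ns)

#y-take : ∀ k ns → k ≤ length ns → #y (charWord (take k ns)) ≡ k
#y-take k ns k≤b = trans (#y-charWord (take k ns)) (trans (LP.length-take k ns) (ℕP.m≤n⇒m⊓n≡m k≤b))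

-- Upper window bound b·S < a·k + b, from comparing the prefixes U and y.
prefix-sum-upper : ∀ a ns k → 1 ≤ length ns → Balanced a (length ns) (charWord ns) → k ≤ length ns →
  length ns * sum (take k ns) < a * k + length ns
prefix-sum-upper a ns k 1≤b bal k≤b =
  ℕP.+-cancelˡ-< a _ _ (subst₂ _<_ (rearrange₁ a b S) (rearrange₂ a b k)
    (balanced-counts bal (take-prefix k ns) (y-prefix ns 1≤b) (#x-charWord (take k ns)) (#y-take k ns k≤b) refl refl))
  where
  b = length ns
  S = sum (take k ns)
  rearrange₁ : ∀ a b S → S * b + 1 * a ≡ a + b * S
  rearrange₁ = ℕSolver.solve-∀
  rearrange₂ : ∀ a b k → 0 * b + k * a + (a + b) ≡ a + (a * k + b)
  rearrange₂ = ℕSolver.solve-∀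

-- Lower window bound a·k < b·(S + 1), from comparing the empty prefix with U y;
-- when U is the whole word, S = a and k = b and the bound is immediate.
prefix-sum-lower : ∀ a ns k → 1 ≤ length ns → Balanced a (length ns) (charWord ns) → sum ns ≡ a →
  k ≤ length ns → a * k < length ns * (sum (take k ns) + 1)
prefix-sum-lower a ns k 1≤b bal sum≡a k≤b with drop k ns in rest
... | [] = subst₂ (λ k' S' → a * k' < b * (S' + 1)) (sym k≡b) (sym S≡a) full-sum
  where
  b = length ns
  take≡ : take k ns ≡ ns
  take≡ = trans (sym (LP.++-identityʳ _)) (trans (cong (take k ns ++_) (sym rest)) (LP.take++drop≡id k ns))
  S≡a : sum (take k ns) ≡ a
  S≡a = trans (cong sum take≡) sum≡a
  k≡b : k ≡ b
  k≡b = trans (sym (#y-take k ns k≤b)) (trans (#y-charWord (take k ns)) (cong length take≡))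
  rearrange : ∀ a b → b * (a + 1) ≡ a * b + b
  rearrange = ℕSolver.solve-∀
  full-sum : a * b < b * (a + 1)
  full-sum = subst₂ _<_ (ℕP.+-identityʳ (a * b)) (sym (rearrange a b)) (ℕP.+-monoʳ-< (a * b) 1≤b)
... | d ∷ ds = ℕP.+-cancelˡ-< a _ _
  (subst₂ _<_ (rearrange₁ a b k) (rearrange₂ a b S)
    (balanced-counts {u₁ = []} bal (_ , refl) Uy-prefix refl refl
      (trans (#x-++ U _) (trans (ℕP.+-identityʳ _) (#x-charWord (take k ns))))
      (trans (#y-++ U _) (cong (_+ 1) (#y-take k ns k≤b)))))
  where
  b = length ns
  S = sum (take k ns)
  U = charWord (take k ns)
  Uy-prefix : IsPrefix (U ++ false ∷ []) (charWord ns)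
  Uy-prefix = x^ d ++ charWord ds ,
    trans (LP.++-assoc U (false ∷ []) _) (sym (trans (charWord-split k ns) (cong (λ r → U ++ charWord r) rest)))
  rearrange₁ : ∀ a b k → 0 * b + (k + 1) * a ≡ a + a * k
  rearrange₁ = ℕSolver.solve-∀
  rearrange₂ : ∀ a b S → S * b + 0 * a + (a + b) ≡ a + b * (S + 1)
  rearrange₂ = ℕSolver.solve-∀

charWord-regular : ∀ a ns → 1 ≤ length ns → sum ns ≡ a → Balanced a (length ns) (charWord ns) →
  IsRegularSeq a ns
charWord-regular a ns 1≤n sum≡a bal i k i<n _ k≤half =
  subst₂ (λ S n → (a * k < n * (S + 1)) × (n * S < a * k + n))
    (sym (window-rotation ns i k i<n k≤n)) (length-rotation ns i)
    ( prefix-sum-lower a (rotation ns i) k (≤-rot 1≤n) rotated-bal (trans (sum-rotation ns i) sum≡a) (≤-rot k≤n)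
    , prefix-sum-upper a (rotation ns i) k (≤-rot 1≤n) rotated-bal (≤-rot k≤n))
  where
  ≤-rot : ∀ {m} → m ≤ length ns → m ≤ length (rotation ns i)
  ≤-rot = subst (_ ≤_) (sym (length-rotation ns i))
  k≤n : k ≤ length ns
  k≤n = half-bound (length ns) k 1≤n k≤half
  split : charWord ns ≡ charWord (take i ns) ++ charWord (drop i ns)
  split = charWord-split i ns
  rotated-bal : Balanced a (length (rotation ns i)) (charWord (rotation ns i))
  rotated-bal = subst₂ (λ n w → Balanced a n w) (sym (length-rotation ns i)) (sym (charWord-++ (drop i ns) (take i ns)))
    (rotate-balanced (charWord (take i ns)) (charWord (drop i ns))
      (subst (λ w → height a (length ns) w ≡ +0) split
        (height-total (charWord ns) (trans (#x-charWord ns) sum≡a) (#y-charWord ns)))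
      (subst (Balanced a (length ns)) split bal))

balanced-regular : ∀ a b w → 1 ≤ b → #x w ≡ a → #y w ≡ b → Balanced a b w →
  RegularConf a b (realize (red ∷ []) (black ∷ []) w)
balanced-regular a b w 1≤b #x≡a #y≡b bal with rotation-to-charWord w (subst (1 ≤_) (sym #y≡b) 1≤b)
... | u , v , ns , refl , rot =
  ns , (realize R B u , realize R B v , realize-++ R B u v ,
        trans (sym (realize-++ R B v u)) (trans (cong (realize R B) rot) (realize-charWord ns))) ,
  length≡b , sum≡a ,
  charWord-regular a ns (subst (1 ≤_) (sym length≡b) 1≤b) sum≡a
    (subst₂ (λ n w' → Balanced a n w') (sym length≡b) rot
      (rotate-balanced u v (height-total (u ++ v) #x≡a #y≡b) bal))
  where
  R = red ∷ []
  B = black ∷ []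
  length≡b : length ns ≡ b
  length≡b = trans (sym (#y-charWord ns)) (trans (cong #y (sym rot)) (trans (additive-rotation #y #y-++ u v) #y≡b))
  sum≡a : sum ns ≡ a
  sum≡a = trans (sym (#x-charWord ns)) (trans (cong #x (sym rot)) (trans (additive-rotation #x #x-++ u v) #x≡a))

theorem1 : (a b : ℕ) → 1 ≤ a → 1 ≤ b →
    ∃[ fuel ] ∃[ out ]
      (findRegular fuel a (red ∷ []) b (black ∷ []) ≡ just out × RegularConf a b out)
theorem1 a b 1≤a 1≤b with findRegular-terminates a b (red ∷ []) (black ∷ []) 1≤a 1≤b
... | out , run , (w , refl , #x≡a , #y≡b , bal) =
  suc (a + b) , out , run , balanced-regular a b w 1≤b #x≡a #y≡b bal
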